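{- For every $n\geq 1$ one has $\lim_{N\to\infty} f^T_N(n)=f^T_{\infty}(n)$.
   Context: Fix $n\geq 1$ and an integer $N\geq 1$. A discrete torus cube packing is a finite family of cubes $z+[0,1]^n$ with $z\in\frac{1}{N}\mathbb{Z}^n$ taken modulo $2\mathbb{Z}^n$ (i.e. in the torus $\mathbb{R}^n/2\mathbb{Z}^n$) that are pairwise non-overlapping, where $z+[0,1]^n$ and $z'+[0,1]^n$ are non-overlapping iff there is an index $i$ with $z_i\equiv z'_i+1 \pmod 2$. Such a packing is non-extensible if it has fewer than $2^n$ cubes and no further cube $z+[0,1]^n$ with $z\in\frac1N\mathbb{Z}^n$ can be added to it. $f^T_N(n)$ denotes the minimal number of cubes of a non-extensible discrete torus cube packing with translation vectors in $\frac1N\mathbb{Z}^n$. A combinatorial torus cube in dimension $n$ is a formal cube $z+[0,1]^n$, $z=(z_1,\dots,z_n)$, where each $z_j$ is either $t$ or $t+1$ for a formal parameter $t$, parameters occurring in different coordinates being distinct. Two combinatorial torus cubes are non-overlapping if there is a coordinate $j$ such that $z_j$ and $z'_j$ involve the same parameter $t$ and $\{z_j,z'_j\}=\{t,t+1\}$. A combinatorial torus cube packing is a finite family of pairwise non-overlapping combinatorial torus cubes; it is non-extensible if it has fewer than $2^n$ cubes and no combinatorial torus cube (whose coordinates may use already occurring or new parameters) can be added keeping pairwise non-overlap. $f^T_\infty(n)$ denotes the minimal number of cubes of a non-extensible combinatorial torus cube packing in dimension $n$. -}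

module Defs where

open import Data.Nat using (ℕ; zero; suc; _+_; _*_; _^_; _≤_; _<_)
open import Data.Fin using (Fin; toℕ)
open import Data.Bool using (Bool)
open import Data.Product using (Σ; ∃; _×_; _,_; proj₁; proj₂)
open import Data.Sum using (_⊎_)
open import Data.List using (List; length)
open import Data.List.Relation.Unary.All using (All)
open import Data.List.Relation.Unary.AllPairs using (AllPairs)
open import Relation.Binary.PropositionalEquality using (_≡_; _≢_)
open import Relation.Nullary using (¬_)

-- Generic: "m is the minimum of the set of naturals P"
-- (if P is empty there is no minimum; the corresponding f is undefined/∞)

IsMinimum : (ℕ → Set) → ℕ → Set
IsMinimum P m = P m × (∀ k → P k → m ≤ k)

-- Discrete torus cubes with translation vectors in (1/N)ℤⁿ mod 2ℤⁿ.
-- A coordinate z_i = k/N (mod 2) is encoded by k ∈ Fin (2 * N).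

DCube : ℕ → ℕ → Set
DCube N n = Fin n → Fin (2 * N)

-- z + [0,1]^n and z' + [0,1]^n are non-overlapping iff ∃ i, z_i ≡ z'_i + 1 (mod 2),
-- i.e. k_i ≡ k'_i + N (mod 2N); as both lie in [0,2N) this means
-- k_i = k'_i + N or k'_i = k_i + N.
DNonOverlap : ∀ N {n} → DCube N n → DCube N n → Set
DNonOverlap N {n} z z' =
  Σ (Fin n) λ i → (toℕ (z i) ≡ toℕ (z' i) + N) ⊎ (toℕ (z' i) ≡ toℕ (z i) + N)

DPacking : ℕ → ℕ → Set
DPacking N n = Σ (List (DCube N n)) (AllPairs (DNonOverlap N))

DNonExtensible : ∀ N {n} → DPacking N n → Set
DNonExtensible N {n} (P , _) =
  length P < 2 ^ n × (∀ (z : DCube N n) → ¬ All (DNonOverlap N z) P)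

DSize : ℕ → ℕ → ℕ → Set
DSize N n m = Σ (DPacking N n) λ P → DNonExtensible N P × length (proj₁ P) ≡ m

fTN≡ : ℕ → ℕ → ℕ → Set
fTN≡ N n m = IsMinimum (DSize N n) m

-- Coordinate j of a cube is (t , b) meaning
-- z_j = t (b = false) or z_j = t + 1 (b = true), where t ∈ ℕ labels a
-- formal parameter attached to coordinate j (parameters in different
-- coordinates are distinct, so labels are per coordinate).

CCube : ℕ → Set
CCube n = Fin n → ℕ × Bool

CNonOverlap : ∀ {n} → CCube n → CCube n → Set
CNonOverlap {n} z z' =
  Σ (Fin n) λ j → (proj₁ (z j) ≡ proj₁ (z' j)) × (proj₂ (z j) ≢ proj₂ (z' j))

CPacking : ℕ → Set
CPacking n = Σ (List (CCube n)) (AllPairs CNonOverlap)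

CNonExtensible : ∀ {n} → CPacking n → Set
CNonExtensible {n} (P , _) =
  length P < 2 ^ n × (∀ (z : CCube n) → ¬ All (CNonOverlap z) P)

CSize : ℕ → ℕ → Set
CSize n m = Σ (CPacking n) λ P → CNonExtensible P × length (proj₁ P) ≡ m

fT∞≡ : ℕ → ℕ → Set
fT∞≡ n m = IsMinimum (CSize n) m

module Submission where

-- For N ≥ 2ⁿ the discrete and the combinatorial problem have exactly the same
-- non-extensible packing sizes, so f^T_N(n) = f^T_∞(n) for all such N; in
-- particular the sequence f^T_N(n) is eventually equal to f^T_∞(n).
--
-- A packing problem is a type of cubes with a disjointness relation.  A
-- "simulation" of a packing P in a second problem maps cubes forth preserving
-- disjointness and maps cubes back so that a cube disjoint from every image is
-- sent to a cube disjoint from every member of P.  Simulations carry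
-- non-extensible packings to non-extensible packings of the same size
-- (transfer).  A coordinate k/N mod 2 with 0 ≤ k < 2N is split as
-- k = r + b·N with r < N, and two coordinates are opposite (differ by 1
-- mod 2) iff they have the same residue r and different bits b
-- (opposite⇒flipped, flipped⇒opposite).
-- Discrete → combinatorial: take the residue as parameter and b as shift;
-- this works for every N ≥ 1.  Combinatorial → discrete: in each coordinate,
-- relabel the parameters of a packing Q by their first position in Q; these
-- labels are ≤ |Q| < 2ⁿ ≤ N, so they are valid residues.

open import Defs
open import Data.Nat using (ℕ; _≤_)
open import Data.Product using (Σ; _×_)
open import Function.Bundles using (_⇔_)

open import Data.Nat using (zero; suc; _+_; _∸_; _*_; _^_; _<_; _<?_; _≟_; z≤n; s≤s; NonZero; >-nonZero)
open import Data.Nat.Properties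
open import Data.Nat.DivMod using (_%_; m%n<n; m<n⇒m%n≡m)
open import Data.Fin using (Fin; toℕ; fromℕ<)
open import Data.Fin.Properties using (toℕ<n; toℕ-fromℕ<)
open import Data.Bool using (Bool; true; false)
open import Data.Product using (_,_; proj₁; proj₂)
open import Data.Sum using (_⊎_; inj₁; inj₂)
open import Data.List using (List; []; _∷_; length; map)
open import Data.List.Properties using (length-map)
open import Data.List.Relation.Unary.All as All using (All)
import Data.List.Relation.Unary.All.Properties as All
open import Data.List.Relation.Unary.Any using (here; there)
import Data.List.Relation.Unary.AllPairs as AllPairs
import Data.List.Relation.Unary.AllPairs.Properties as AllPairs
open import Data.List.Relation.Unary.AllPairs using (AllPairs)
open import Data.List.Membership.Propositional using (_∈_)
open import Data.List.Membership.Propositional.Properties using (∈-map⁺)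
open import Data.Empty using (⊥-elim)
open import Relation.Binary.PropositionalEquality
open import Relation.Nullary using (¬_; yes; no)
open import Function.Bundles using (mk⇔)

minimum-cong : {P Q : ℕ → Set} {m : ℕ} →
  (∀ k → P k → Q k) → (∀ k → Q k → P k) → IsMinimum P m ⇔ IsMinimum Q m
minimum-cong {m = m} P⇒Q Q⇒P =
  mk⇔ (λ (pm , least) → P⇒Q m pm , λ k qk → least k (Q⇒P k qk))
      (λ (qm , least) → Q⇒P m qm , λ k pk → least k (P⇒Q k pk))

-- DSize and CSize are instances of this notion.
NonExtensibleSize : (X : Set) → (X → X → Set) → ℕ → ℕ → Set
NonExtensibleSize X R s m = Σ (Σ (List X) (AllPairs R)) λ P →
  (length (proj₁ P) < s × (∀ x → ¬ All (R x) (proj₁ P))) × length (proj₁ P) ≡ m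

record Simulation {X Y : Set} (R : X → X → Set) (S : Y → Y → Set) (P : List X) : Set where
  field
    forth          : X → Y
    forth-disjoint : ∀ {x x'} → R x x' → S (forth x) (forth x')
    back           : Y → X
    back-disjoint  : ∀ {x} y → x ∈ P → S y (forth x) → R (back y) x

transfer : {X Y : Set} {R : X → X → Set} {S : Y → Y → Set} {s m : ℕ} →
  (∀ P → length P < s → Simulation R S P) →
  NonExtensibleSize X R s m → NonExtensibleSize Y S s m
transfer {S = S} {s} simulate ((P , disjoint) , (small , maximal) , size) =
  (map forth P , AllPairs.map⁺ (AllPairs.map forth-disjoint disjoint)) ,
  (subst (_< s) (sym same-length) small , maximal′) ,
  trans same-length size
  where
    open Simulation (simulate P small)
    same-length : length (map forth P) ≡ length P
    same-length = length-map forth P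
    -- a cube y disjoint from every image would pull back to one disjoint from P
    maximal′ : ∀ y → ¬ All (S y) (map forth P)
    maximal′ y all = maximal (back y)
      (All.tabulate λ x∈P → back-disjoint y x∈P (All.lookup (All.map⁻ all) x∈P))

-- Relabelling a list of parameters by positions: the first position of t in
-- xs (or |xs| if t does not occur), and the entry at a position (0 if none).
position : ℕ → List ℕ → ℕ
position t [] = 0
position t (x ∷ xs) with x ≟ t
... | yes _ = 0
... | no  _ = suc (position t xs)

entry : ℕ → List ℕ → ℕ
entry _       []       = 0
entry zero    (x ∷ _)  = x
entry (suc k) (_ ∷ xs) = entry k xs

position≤length : ∀ t xs → position t xs ≤ length xs
position≤length t [] = z≤n
position≤length t (x ∷ xs) with x ≟ t
... | yes _ = z≤n
... | no  _ = s≤s (position≤length t xs)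

entry-position : ∀ {t} xs → t ∈ xs → entry (position t xs) xs ≡ t
entry-position {t} (x ∷ xs) t∈ with x ≟ t
entry-position (x ∷ xs) _           | yes x≡t = x≡t
entry-position (x ∷ xs) (here t≡x)  | no  x≢t = ⊥-elim (x≢t (sym t≡x))
entry-position (x ∷ xs) (there t∈) | no  _   = entry-position xs t∈

module Coordinates (N : ℕ) .{{_ : NonZero N}} where

  -- Discrete coordinates a/N and b/N (with a, b < 2N) differ by 1 mod 2.
  Opposite : ℕ → ℕ → Set
  Opposite a b = (a ≡ b + N) ⊎ (b ≡ a + N)

  Flipped : ℕ × Bool → ℕ × Bool → Set
  Flipped (t , b) (t' , b') = t ≡ t' × b ≢ b'

  encode : ℕ × Bool → ℕ
  encode (r , false) = r
  encode (r , true)  = r + N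

  -- 2 * N only unfolds to N + (N + 0).
  double : 2 * N ≡ N + N
  double = cong (N +_) (+-identityʳ N)

  encode< : ∀ {r} b → r < N → encode (r , b) < 2 * N
  encode< {r} false r<N = ≤-trans r<N (m≤m+n N (N + 0))
  encode< {r} true  r<N = subst (r + N <_) (sym double) (+-monoˡ-< N r<N)

  split : ∀ k → k < 2 * N → Σ (ℕ × Bool) λ x → proj₁ x < N × encode x ≡ k
  split k k<2N with k <? N
  ... | yes k<N = (k , false) , k<N , refl
  ... | no  k≮N = (k ∸ N , true) , m<n+o⇒m∸n<o k N (subst (k <_) double k<2N) ,
                  m∸n+n≡m (≮⇒≥ k≮N)

  below-shift : ∀ {r} s → r < N → r ≢ s + N
  below-shift {r} s r<N r≡s+N = <⇒≱ r<N (subst (N ≤_) (sym r≡s+N) (m≤n+m N s))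

  opposite⇒flipped : ∀ {r r'} b b' → r < N → r' < N →
    Opposite (encode (r , b)) (encode (r' , b')) → Flipped (r , b) (r' , b')
  opposite⇒flipped false false r<N  r'<N (inj₁ e) = ⊥-elim (below-shift _ r<N e)
  opposite⇒flipped false false r<N  r'<N (inj₂ e) = ⊥-elim (below-shift _ r'<N e)
  opposite⇒flipped true  false r<N  r'<N (inj₁ e) = +-cancelʳ-≡ N _ _ e , λ ()
  opposite⇒flipped true  false r<N  r'<N (inj₂ e) = ⊥-elim (below-shift _ r'<N e)
  opposite⇒flipped false true  r<N  r'<N (inj₁ e) = ⊥-elim (below-shift _ r<N e)
  opposite⇒flipped false true  r<N  r'<N (inj₂ e) = sym (+-cancelʳ-≡ N _ _ e) , λ ()
  opposite⇒flipped true  true  r<N  r'<N (inj₁ e) = ⊥-elim (below-shift _ r<N (+-cancelʳ-≡ N _ _ e))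
  opposite⇒flipped true  true  r<N  r'<N (inj₂ e) = ⊥-elim (below-shift _ r'<N (+-cancelʳ-≡ N _ _ e))

  flipped⇒opposite : ∀ x x' → Flipped x x' → Opposite (encode x) (encode x')
  flipped⇒opposite (r , false) (.r , false) (refl , b≢b') = ⊥-elim (b≢b' refl)
  flipped⇒opposite (r , false) (.r , true)  (refl , _)    = inj₂ refl
  flipped⇒opposite (r , true)  (.r , false) (refl , _)    = inj₁ refl
  flipped⇒opposite (r , true)  (.r , true)  (refl , b≢b') = ⊥-elim (b≢b' refl)

  embed : ℕ × Bool → Fin (2 * N)
  embed (t , b) = fromℕ< (encode< b (m%n<n t N))

  embed-encode : ∀ {r} b → r < N → toℕ (embed (r , b)) ≡ encode (r , b)
  embed-encode {r} b r<N = trans (toℕ-fromℕ< _) (cong (λ t → encode (t , b)) (m<n⇒m%n≡m r<N))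

  decode : Fin (2 * N) → ℕ × Bool
  decode a = proj₁ (split (toℕ a) (toℕ<n a))

  decode-residue : ∀ a → proj₁ (decode a) < N
  decode-residue a = proj₁ (proj₂ (split (toℕ a) (toℕ<n a)))

  encode-decode : ∀ a → encode (decode a) ≡ toℕ a
  encode-decode a = proj₂ (proj₂ (split (toℕ a) (toℕ<n a)))

  opposite-decode : ∀ a {r} b → r < N →
    Opposite (toℕ a) (encode (r , b)) → Flipped (decode a) (r , b)
  opposite-decode a b r<N opp =
    opposite⇒flipped (proj₂ (decode a)) b (decode-residue a) r<N
      (subst (λ k → Opposite k _) (sym (encode-decode a)) opp)

  discrete-simulation : ∀ {n} (P : List (DCube N n)) →
    Simulation (DNonOverlap N) CNonOverlap P
  discrete-simulation P = record
    { forth          = λ z j → decode (z j)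
    ; forth-disjoint = λ { {z} {z'} (i , opp) → i , opposite-decode (z i) (proj₂ (decode (z' i)))
        (decode-residue (z' i)) (subst (Opposite _) (sym (encode-decode (z' i))) opp) }
    ; back           = λ c j → embed (c j)
    ; back-disjoint  = λ { {z} c _ (j , flipped) → j , opposite-embed (c j) (z j) flipped }
    }
    where
      opposite-embed : ∀ x a → Flipped x (decode a) → Opposite (toℕ (embed x)) (toℕ a)
      opposite-embed (t , b) a (refl , b≢) =
        subst₂ Opposite (sym (embed-encode b (decode-residue a))) (encode-decode a)
          (flipped⇒opposite (t , b) (decode a) (refl , b≢))

  -- Combinatorial → discrete, for packings Q with |Q| < N: in each coordinate a
  -- parameter becomes its first position among that coordinate's parameters of Q.
  combinatorial-simulation : ∀ {n} (Q : List (CCube n)) → length Q < N →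
    Simulation CNonOverlap (DNonOverlap N) Q
  combinatorial-simulation {n} Q |Q|<N = record
    { forth          = relabel
    ; forth-disjoint = λ { {q} {q'} (j , t≡t' , b≢b') → j ,
        subst₂ Opposite (sym (relabel-encode q j)) (sym (relabel-encode q' j))
          (flipped⇒opposite _ _ (cong (λ t → position t (labels j)) t≡t' , b≢b')) }
    ; back           = unlabel
    ; back-disjoint  = λ { {q} d q∈Q (j , opp) → j , unlabel-flipped q d j q∈Q opp }
    }
    where
      labels : Fin n → List ℕ
      labels j = map (λ q → proj₁ (q j)) Q

      label : CCube n → Fin n → ℕ
      label q j = position (proj₁ (q j)) (labels j)

      label<N : ∀ q j → label q j < N
      label<N q j = ≤-<-trans (position≤length (proj₁ (q j)) (labels j))
        (subst (_< N) (sym (length-map _ Q)) |Q|<N)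

      relabel : CCube n → DCube N n
      relabel q j = embed (label q j , proj₂ (q j))

      relabel-encode : ∀ q j → toℕ (relabel q j) ≡ encode (label q j , proj₂ (q j))
      relabel-encode q j = embed-encode (proj₂ (q j)) (label<N q j)

      unlabel : DCube N n → CCube n
      unlabel d j = entry (proj₁ (decode (d j))) (labels j) , proj₂ (decode (d j))

      unlabel-flipped : ∀ q (d : DCube N n) j → q ∈ Q →
        Opposite (toℕ (d j)) (toℕ (relabel q j)) → Flipped (unlabel d j) (q j)
      unlabel-flipped q d j q∈Q opp with opposite-decode (d j) (proj₂ (q j)) (label<N q j)
                                          (subst (Opposite _) (relabel-encode q j) opp)
      ... | r≡label , b≢b' =
        trans (cong (λ r → entry r (labels j)) r≡label)
              (entry-position (labels j) (∈-map⁺ (λ q → proj₁ (q j)) q∈Q)) , b≢b'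

proposition1 : ∀ (n : ℕ) → 1 ≤ n →
    Σ ℕ λ N₀ → ∀ (N : ℕ) → N₀ ≤ N → 1 ≤ N →
      ∀ (m : ℕ) → fTN≡ N n m ⇔ fT∞≡ n m
proposition1 n _ = 2 ^ n , λ N 2ⁿ≤N 1≤N m →
  let open Coordinates N {{>-nonZero 1≤N}} in
  minimum-cong
    (λ _ → transfer λ P _ → discrete-simulation P)
    (λ _ → transfer λ Q |Q|<2ⁿ → combinatorial-simulation Q (<-≤-trans |Q|<2ⁿ 2ⁿ≤N))
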